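{- Let $\rho_1,\rho_2\in SC$ with $\rho_1 \sim \rho_2$. Then for every $\sigma\in SC$ and every binary relation $\mathcal{B}$ on $SC$: if $\rho_1 \mid \sigma$ has no $\tau$-transition with respect to $\mathcal{B}$, then $\rho_2 \mid \sigma$ has no $\tau$-transition with respect to $\mathcal{B}$.
   Context: Fix a set $BT$ of base types with a preorder $\le_:$ (e.g. $\mathsf{Int}\le_:\mathsf{Real}$) and a countable set of labels. Contract terms: $\sigma ::= \mathbf{1} \mid ?t.\sigma \mid !t.\sigma \mid ?(\sigma').\sigma \mid !(\sigma').\sigma \mid \sum_{i\in I} ?l_i.\sigma_i \mid \bigoplus_{i\in I} !l_i.\sigma_i \mid \mu x.\sigma \mid x$, where $t\in BT$, $I$ is finite and nonempty, the labels $l_i$ are pairwise distinct, and $x$ ranges over variables. A term is guarded if for every subterm $\mu x.\sigma$, every occurrence of $x$ in $\sigma$ lies under a constructor other than $\mu$. $SC$ (session contracts) is the set of closed guarded terms; $\sigma\{\rho/x\}$ denotes substitution of the closed term $\rho$ for the free occurrences of $x$. Actions: $\mathsf{Act}=\{?l,!l\}\cup\{?t,!t : t\in BT\}\cup\{?(\sigma),!(\sigma):\sigma\in SC\}$. Transitions $\sigma\xrightarrow{\mu}\sigma'$, $\mu\in\mathsf{Act}\cup\{\tau,\mathsf{ok}\}$, are exactly: $\mathbf{1}\xrightarrow{\mathsf{ok}}$; $\lambda.\sigma\xrightarrow{\lambda}\sigma$ for a prefix $\lambda\in\mathsf{Act}$ (covering $?t.\sigma$, $!t.\sigma$, $?(\sigma').\sigma$,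 $!(\sigma').\sigma$ and the one-summand internal sum $!l.\sigma$); $\sum_{i\in I}?l_i.\sigma_i\xrightarrow{?l_k}\sigma_k$ for $k\in I$; $\bigoplus_{i\in I}!l_i.\sigma_i\xrightarrow{\tau}!l_k.\sigma_k$ for $k\in I$ when $|I|>1$; $\mu x.\sigma\xrightarrow{\tau}\sigma\{\mu x.\sigma/x\}$. Given a binary relation $\mathcal{B}$ on $SC$, $\lambda_1\bowtie_{\mathcal{B}}\lambda_2$ holds iff $(\lambda_1,\lambda_2)$ is $(!l,?l)$ or $(?l,!l)$; or $(!t_1,?t_2)$ with $t_1\le_: t_2$; or $(?t_1,!t_2)$ with $t_2\le_: t_1$; or $(!(\sigma_1),?(\sigma_2))$ with $\sigma_1\mathcal{B}\sigma_2$; or $(?(\sigma_1),!(\sigma_2))$ with $\sigma_2\mathcal{B}\sigma_1$. The $\tau$-transitions $\rho\mid\sigma \xrightarrow{\tau}_{\mathcal{B}} \rho'\mid\sigma'$ are: $\rho\xrightarrow{\tau}\rho'$ and $\sigma'=\sigma$; or $\sigma\xrightarrow{\tau}\sigma'$ and $\rho'=\rho$; or $\rho\xrightarrow{\lambda_1}\rho'$, $\sigma\xrightarrow{\lambda_2}\sigma'$ with $\lambda_1\bowtie_{\mathcal{B}}\lambda_2$. A strong bisimulation is a relation $R\subseteq SC\times SC$ such that whenever $\sigma_1 R\sigma_2$: $\sigma_1\xrightarrow{\mathsf{ok}}$ iff $\sigma_2\xrightarrow{\mathsf{ok}}$, and for every $\mu\in\mathsf{Act}\cup\{\tau\}$,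 $\sigma_1\xrightarrow{\mu}\sigma_1'$ implies $\sigma_2\xrightarrow{\mu}\sigma_2'$ for some $\sigma_2'$ with $\sigma_1' R\sigma_2'$, and symmetrically. $\sigma_1\sim\sigma_2$ iff some strong bisimulation relates them. -}

module Defs where

open import Data.Nat using (ℕ; zero; suc; _<_)
open import Data.Fin using (Fin; zero; suc)
open import Data.Product using (Σ; ∃; ∃-syntax; _×_; _,_; proj₁; proj₂)
open import Data.List using (List; []; _∷_; map; length)
open import Data.List.NonEmpty using (List⁺; _∷_; toList)
open import Data.List.Membership.Propositional using (_∈_)
open import Data.List.Relation.Unary.AllPairs using (AllPairs)
open import Relation.Binary.PropositionalEquality using (_≡_; _≢_)
open import Relation.Nullary using (¬_)
open import Function.Bundles using (_⇔_)

-- Labels: a countable (infinite) set, represented by ℕ.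
Label : Set
Label = ℕ

-- Everything is parametrised by the set BT of base types and its relation ≤:
-- (the preorder assumption is stated in the theorem).
module Contracts (BT : Set) (_≤:_ : BT → BT → Set) where

  -- Contract terms, variables in de Bruijn form (Term n: at most n free vars).
  data Term (n : ℕ) : Set where
    one  : Term n
    inT  : BT → Term n → Term n                     -- ?t.σ
    outT : BT → Term n → Term n                     -- !t.σ
    inS  : Term n → Term n → Term n                 -- ?(σ').σ
    outS : Term n → Term n → Term n                 -- !(σ').σ
    ext  : List⁺ (Label × Term n) → Term n          -- Σ_{i∈I} ?l_i.σ_i
    int  : List⁺ (Label × Term n) → Term n          -- ⊕_{i∈I} !l_i.σ_i
    mu   : Term (suc n) → Term n
    var  : Fin n → Term n

  mutual
    rename : ∀ {n m} → (Fin n → Fin m) → Term n → Term m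
    rename f one = one
    rename f (inT t s) = inT t (rename f s)
    rename f (outT t s) = outT t (rename f s)
    rename f (inS s' s) = inS (rename f s') (rename f s)
    rename f (outS s' s) = outS (rename f s') (rename f s)
    rename f (ext (x ∷ xs)) = ext (renameB f x ∷ renameBs f xs)
    rename f (int (x ∷ xs)) = int (renameB f x ∷ renameBs f xs)
    rename f (mu s) = mu (rename (liftR f) s)
    rename f (var i) = var (f i)

    renameB : ∀ {n m} → (Fin n → Fin m) → Label × Term n → Label × Term m
    renameB f (l , s) = l , rename f s

    renameBs : ∀ {n m} → (Fin n → Fin m) → List (Label × Term n) → List (Label × Term m)
    renameBs f [] = []
    renameBs f (x ∷ xs) = renameB f x ∷ renameBs f xs

    liftR : ∀ {n m} → (Fin n → Fin m) → Fin (suc n) → Fin (suc m)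
    liftR f zero = zero
    liftR f (suc i) = suc (f i)

  liftS : ∀ {n m} → (Fin n → Term m) → Fin (suc n) → Term (suc m)
  liftS f zero = var zero
  liftS f (suc i) = rename suc (f i)

  mutual
    sub : ∀ {n m} → (Fin n → Term m) → Term n → Term m
    sub f one = one
    sub f (inT t s) = inT t (sub f s)
    sub f (outT t s) = outT t (sub f s)
    sub f (inS s' s) = inS (sub f s') (sub f s)
    sub f (outS s' s) = outS (sub f s') (sub f s)
    sub f (ext (x ∷ xs)) = ext (subB f x ∷ subBs f xs)
    sub f (int (x ∷ xs)) = int (subB f x ∷ subBs f xs)
    sub f (mu s) = mu (sub (liftS f) s)
    sub f (var i) = f i

    subB : ∀ {n m} → (Fin n → Term m) → Label × Term n → Label × Term m
    subB f (l , s) = l , sub f s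

    subBs : ∀ {n m} → (Fin n → Term m) → List (Label × Term n) → List (Label × Term m)
    subBs f [] = []
    subBs f (x ∷ xs) = subB f x ∷ subBs f xs

  _[_/0] : Term 1 → Term 0 → Term 0
  s [ r /0] = sub (λ { zero → r ; (suc ()) }) s

  data Unguarded : ∀ {n} → Fin n → Term n → Set where
    ug-var : ∀ {n} {x : Fin n} → Unguarded x (var x)
    ug-mu  : ∀ {n} {x : Fin n} {s} → Unguarded (suc x) s → Unguarded x (mu s)

  Distinct : ∀ {n} → List⁺ (Label × Term n) → Set
  Distinct xs = AllPairs _≢_ (map proj₁ (toList xs))

  mutual
    data WF {n : ℕ} : Term n → Set where
      wf-one  : WF one
      wf-inT  : ∀ {t s} → WF s → WF (inT t s)
      wf-outT : ∀ {t s} → WF s → WF (outT t s)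
      wf-inS  : ∀ {s' s} → WF s' → WF s → WF (inS s' s)
      wf-outS : ∀ {s' s} → WF s' → WF s → WF (outS s' s)
      wf-ext  : ∀ {xs} → Distinct xs → WFs (toList xs) → WF (ext xs)
      wf-int  : ∀ {xs} → Distinct xs → WFs (toList xs) → WF (int xs)
      wf-mu   : ∀ {s} → ¬ Unguarded zero s → WF s → WF (mu s)
      wf-var  : ∀ {i} → WF (var i)

    data WFs {n : ℕ} : List (Label × Term n) → Set where
      []  : WFs []
      _∷_ : ∀ {l s xs} → WF s → WFs xs → WFs ((l , s) ∷ xs)

  SC : Set
  SC = Σ (Term 0) WF

  term : SC → Term 0
  term = proj₁

  -- actions (the contracts carried by ?(σ), !(σ) are closed subterms
  -- of session contracts, hence themselves session contracts)
  data Act : Set where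
    inL  : Label → Act
    outL : Label → Act
    inB  : BT → Act
    outB : BT → Act
    inC  : Term 0 → Act
    outC : Term 0 → Act

  data Lbl : Set where
    τ   : Lbl
    act : Act → Lbl

  data Ok : Term 0 → Set where
    ok-one : Ok one

  data _—[_]→_ : Term 0 → Lbl → Term 0 → Set where
    t-inT  : ∀ {t s} → inT t s —[ act (inB t) ]→ s
    t-outT : ∀ {t s} → outT t s —[ act (outB t) ]→ s
    t-inS  : ∀ {s' s} → inS s' s —[ act (inC s') ]→ s
    t-outS : ∀ {s' s} → outS s' s —[ act (outC s') ]→ s
    t-out1 : ∀ {l s} → int ((l , s) ∷ []) —[ act (outL l) ]→ s
    t-ext  : ∀ {xs l s} → (l , s) ∈ toList xs → ext xs —[ act (inL l) ]→ s
    t-int  : ∀ {xs l s} → 1 < length (toList xs) → (l , s) ∈ toList xs →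
             int xs —[ τ ]→ int ((l , s) ∷ [])
    t-mu   : ∀ {s} → mu s —[ τ ]→ (s [ mu s /0])

  data Compat (B : SC → SC → Set) : Act → Act → Set where
    c-outL : ∀ {l} → Compat B (outL l) (inL l)
    c-inL  : ∀ {l} → Compat B (inL l) (outL l)
    c-outB : ∀ {t₁ t₂} → t₁ ≤: t₂ → Compat B (outB t₁) (inB t₂)
    c-inB  : ∀ {t₁ t₂} → t₂ ≤: t₁ → Compat B (inB t₁) (outB t₂)
    c-outC : ∀ {s₁ s₂} (w₁ : WF s₁) (w₂ : WF s₂) →
             B (s₁ , w₁) (s₂ , w₂) → Compat B (outC s₁) (inC s₂)
    c-inC  : ∀ {s₁ s₂} (w₁ : WF s₁) (w₂ : WF s₂) →
             B (s₂ , w₂) (s₁ , w₁) → Compat B (inC s₁) (outC s₂)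

  data ParStep (B : SC → SC → Set) : SC → SC → SC → SC → Set where
    p-left  : ∀ {ρ σ ρ' σ'} → term ρ —[ τ ]→ term ρ' → term σ' ≡ term σ →
              ParStep B ρ σ ρ' σ'
    p-right : ∀ {ρ σ ρ' σ'} → term σ —[ τ ]→ term σ' → term ρ' ≡ term ρ →
              ParStep B ρ σ ρ' σ'
    p-sync  : ∀ {ρ σ ρ' σ' λ₁ λ₂} → term ρ —[ act λ₁ ]→ term ρ' →
              term σ —[ act λ₂ ]→ term σ' → Compat B λ₁ λ₂ →
              ParStep B ρ σ ρ' σ'

  NoTau : (SC → SC → Set) → SC → SC → Set
  NoTau B ρ σ = ∀ ρ' σ' → ¬ ParStep B ρ σ ρ' σ'

  IsStrongBisim : (SC → SC → Set) → Set
  IsStrongBisim R = ∀ σ₁ σ₂ → R σ₁ σ₂ →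
      (Ok (term σ₁) ⇔ Ok (term σ₂))
    × (∀ μ σ₁' → term σ₁ —[ μ ]→ term σ₁' →
         ∃[ σ₂' ] (term σ₂ —[ μ ]→ term σ₂' × R σ₁' σ₂'))
    × (∀ μ σ₂' → term σ₂ —[ μ ]→ term σ₂' →
         ∃[ σ₁' ] (term σ₁ —[ μ ]→ term σ₁' × R σ₁' σ₂'))

  _∼_ : SC → SC → Set₁
  σ₁ ∼ σ₂ = ∃[ R ] (IsStrongBisim R × R σ₁ σ₂)

-- A τ-step of ρ ∣ σ is either a step of σ alone, which does not involve ρ,
-- or uses a single transition of ρ (a τ-step or a synchronising action).
-- Bisimilar contracts have transitions with the same labels, so every such
-- step of ρ₂ ∣ σ is mirrored by one of ρ₁ ∣ σ; only that one direction of
-- the bisimulation is needed, and nothing depends on B or on ≤: being a preorder.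
module Submission where

open import Defs
open import Data.Product using (∃-syntax; _,_)
open import Relation.Binary.PropositionalEquality using (_≡_; refl)
open import Relation.Binary.Structures using (IsPreorder)

module _ {BT : Set} {_≤:_ : BT → BT → Set} where
  open Contracts BT _≤:_

  CanDo : SC → Lbl → Set
  CanDo ρ μ = ∃[ ρ' ] (term ρ —[ μ ]→ term ρ')

  _CanMimic_ : SC → SC → Set
  ρ₁ CanMimic ρ₂ = ∀ μ ρ₂' → term ρ₂ —[ μ ]→ term ρ₂' → CanDo ρ₁ μ

  ∼⇒CanMimic : ∀ {ρ₁ ρ₂} → ρ₁ ∼ ρ₂ → ρ₁ CanMimic ρ₂
  ∼⇒CanMimic {ρ₁} {ρ₂} (R , bisim , ρ₁Rρ₂) μ ρ₂' step
    with bisim ρ₁ ρ₂ ρ₁Rρ₂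
  ... | _ , _ , backward with backward μ ρ₂' step
  ... | ρ₁' , step₁ , _ = ρ₁' , step₁

  ParStep-mimic : ∀ {B ρ₁ ρ₂ σ ρ₂' σ'} → ρ₁ CanMimic ρ₂ →
                  ParStep B ρ₂ σ ρ₂' σ' → ∃[ ρ₁' ] ∃[ σ₁' ] ParStep B ρ₁ σ ρ₁' σ₁'
  ParStep-mimic {σ = σ} {ρ₂' = ρ₂'} mimic (p-left step _)
    with mimic τ ρ₂' step
  ... | ρ₁' , step₁ = ρ₁' , σ , p-left step₁ refl
  ParStep-mimic {ρ₁ = ρ₁} {σ' = σ'} mimic (p-right step _) =
    ρ₁ , σ' , p-right step refl
  ParStep-mimic {ρ₂' = ρ₂'} {σ' = σ'} mimic (p-sync {λ₁ = λ₁} step₂ stepσ compat)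
    with mimic (act λ₁) ρ₂' step₂
  ... | ρ₁' , step₁ = ρ₁' , σ' , p-sync step₁ stepσ compat

  NoTau-mimic : ∀ {B ρ₁ ρ₂ σ} → ρ₁ CanMimic ρ₂ → NoTau B ρ₁ σ → NoTau B ρ₂ σ
  NoTau-mimic mimic noTau ρ₂' σ' step
    with ParStep-mimic mimic step
  ... | ρ₁' , σ₁' , step₁ = noTau ρ₁' σ₁' step₁

lemma3p3 : (BT : Set) (_≤:_ : BT → BT → Set) → IsPreorder _≡_ _≤:_ →
    let open Contracts BT _≤:_ in
    (ρ₁ ρ₂ : SC) → ρ₁ ∼ ρ₂ →
    (σ : SC) (B : SC → SC → Set) → NoTau B ρ₁ σ → NoTau B ρ₂ σ
lemma3p3 _ _ _ _ _ ρ₁∼ρ₂ _ _ = NoTau-mimic (∼⇒CanMimic ρ₁∼ρ₂)
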